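{- Let $n\ge 2$ and $S\subseteq\{1,\dots,n-1\}$, and write $S+n=S\cup\{n\}$. In the network $\mathcal N^n$ at parameter values $(\lambda^{n,S+n},\mu^{n,S+n})$, the flow $x^{n,S+n}$ is a feasible flow and satisfies the conditions (SCS) with respect to $S+n$. Consequently, $\{s\}\cup S\cup\{n\}$ is the unique minimum $s$--$t$ cut of $\mathcal N^n$ at $(\lambda^{n,S+n},\mu^{n,S+n})$.
   Context: **Numbers.** Define $a^n_{sj}, b^n_{sj}$ (for $n\ge1$, $1\le j\le n$), $\theta^n$ and $\phi^n$ (for $n\ge2$) recursively: - $a^1_{s1}=b^1_{s1}=1$; - $\theta^n=3a^{n-1}_{s,n-1}$; - $\phi^2=4$, and $\phi^n=4\sum_{j<n}(\theta^n b^{n-1}_{sj}-3a^{n-1}_{sj})$ for $n>2$; - $a^n_{sj}=4a^{n-1}_{sj}$ and $b^n_{sj}=(1+\theta^n)b^{n-1}_{sj}$ for $j<n$; - $a^n_{sn}=\phi^n$ and $b^n_{sn}=1$. **Network $\mathcal N^n$.** The nodes are $s$, $t$ and $N^n=\{1,\dots,n\}$. The arcs are $s\to j$ and $j\to t$ for $j\in N^n$, and $j\to k$ for $j,k\in N^n$ with $j>k$. Capacities are: - $u^n_{sj}(\lambda,\mu)=a^n_{sj}\lambda+b^n_{sj}\mu$ for all $n\ge1$ and $j\in N^n$; - $u^1_{1t}=1$; - for $n\ge2$ and $j<n$: $u^n_{jt}=u^{n-1}_{jt}+\theta^n b^{n-1}_{sj}$; - $u^n_{nt}=\phi^n/2$;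 - $u^n_{ij}=u^{n-1}_{ij}$ for $n-1\ge i>j$; - $u^n_{nj}=\theta^n b^{n-1}_{sj}-3a^{n-1}_{sj}$ for $j<n$. **Points.** For $S\subseteq N^n$ define the point $(\lambda^{n,S},\mu^{n,S})$ by: - $(\lambda^{1,\emptyset},\mu^{1,\emptyset})=(1/4,1/4)$ and $(\lambda^{1,\{1\}},\mu^{1,\{1\}})=(3/4,3/4)$; - for $n\ge2$ and $S\subseteq N^{n-1}$: $(\lambda^{n,S},\mu^{n,S})=\left(\frac{\lambda^{n-1,S}}{4},\frac{\mu^{n-1,S}+\theta^n}{1+\theta^n}\right)$; - for $n\ge2$ and $S\subseteq N^{n-1}$: $(\lambda^{n,S\cup\{n\}},\mu^{n,S\cup\{n\}})=\left(\frac{\lambda^{n-1,S}+3}{4},\frac{\mu^{n-1,S}}{1+\theta^n}\right)$. **Flows.** For $S\subseteq N^n$ define the flow $x^{n,S}$ by: - $x^{1,\emptyset}_{s1}=x^{1,\emptyset}_{1t}=1/2$ and $x^{1,\{1\}}_{s1}=x^{1,\{1\}}_{1t}=1$. - For $n\ge2$ and $S\subseteq N^{n-1}$, the flow $x^{n,S}$ is given, for $j,i\in N^{n-1}$ with $i>j$, by: - $x^{n,S}_{sj}=x^{n-1,S}_{sj}+\theta^n b^{n-1}_{sj}$; - $x^{n,S}_{jt}=x^{n-1,S}_{jt}+\theta^n b^{n-1}_{sj}$; - $x^{n,S}_{ij}=x^{n-1,S}_{ij}$; - $x^{n,S}_{nj}=0$; - $x^{n,S}_{sn}=x^{n,S}_{nt}=\phi^n\lambda^{n,S}+\mu^{n,S}$.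 - For $n\ge2$ and $S\subseteq N^{n-1}$, the flow $x^{n,S\cup\{n\}}$ is given, for $j,i\in N^{n-1}$ with $i>j$, by: - $x_{sj}=x^{n-1,S}_{sj}+3a^{n-1}_{sj}$; - $x_{jt}=x^{n-1,S}_{jt}+\theta^n b^{n-1}_{sj}$; - $x_{ij}=x^{n-1,S}_{ij}$; - $x_{nj}=\theta^n b^{n-1}_{sj}-3a^{n-1}_{sj}$; - $x_{sn}=\phi^n/2+\sum_{j<n}(\theta^n b^{n-1}_{sj}-3a^{n-1}_{sj})$; - $x_{nt}=\phi^n/2$. **(SCS).** A flow $x$ in $\mathcal N^n$ at parameter values $(\lambda,\mu)$, with capacities $u$ evaluated there, satisfies (SCS) with respect to $T\subseteq N^n$ if all of the following hold: - for $j\in T$: $x_{sj}<u_{sj}$ and $x_{jt}=u_{jt}$; - for $j\notin T$: $x_{sj}=u_{sj}$ and $x_{jt}<u_{jt}$; - for $j>k$ with $j\in T$ and $k\notin T$: $x_{jk}=u_{jk}$; - for $j>k$ with $j\notin T$ and $k\in T$: $x_{jk}=0$. A flow is feasible if it satisfies the capacity bounds and flow conservation at internal nodes. -}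

module Defs where

open import Data.Bool using (Bool; true; false; if_then_else_; _∧_; _∨_; not)
open import Data.Nat as ℕ using (ℕ; zero; suc; _<ᵇ_; _≡ᵇ_; _∸_)
open import Data.Integer using (+_)
open import Data.Rational using (ℚ; 0ℚ; 1ℚ; _+_; _*_; _-_; _÷_; _/_; _≤_; _<_)
open import Data.Rational.Properties using (_≟_)
open import Data.Product using (_×_; _,_; proj₁; proj₂)
open import Relation.Nullary using (yes; no)
open import Relation.Binary.PropositionalEquality using (_≡_)

ι : ℕ → ℚ
ι k = + k / 1

-- total division (returns 0 when dividing by 0; only ever used with
-- nonzero denominators 1 + θⁿ, 4, 2)
_÷'_ : ℚ → ℚ → ℚ
p ÷' q with q ≟ 0ℚ
... | yes _ = 0ℚ
... | no q≢0 = _÷_ p q {{Data.Rational.≢-nonZero q≢0}}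

sumR : ℕ → (ℕ → ℚ) → ℚ
sumR zero    f = 0ℚ
sumR (suc m) f = sumR m f + f (suc m)

-- The numbers aⁿ_{sj}, bⁿ_{sj}, θⁿ, φⁿ.
-- a n j, b n j are meaningful for 1 ≤ j ≤ n; θ n, φ n for n ≥ 2.
-- Values outside these ranges are junk and never used.

mutual
  a : ℕ → ℕ → ℚ
  a zero          j = 0ℚ
  a (suc zero)    j = 1ℚ
  a (suc (suc m)) j =
    if j <ᵇ suc (suc m) then ι 4 * a (suc m) j else φ (suc (suc m))

  b : ℕ → ℕ → ℚ
  b zero          j = 0ℚ
  b (suc zero)    j = 1ℚ
  b (suc (suc m)) j =
    if j <ᵇ suc (suc m) then (1ℚ + θ (suc (suc m))) * b (suc m) j else 1ℚ

  θ : ℕ → ℚ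
  θ zero    = 0ℚ
  θ (suc m) = ι 3 * a m m

  φ : ℕ → ℚ
  φ zero                = 0ℚ
  φ (suc zero)          = 0ℚ
  φ (suc (suc zero))    = ι 4
  φ (suc (suc (suc k))) =
    ι 4 * sumR (suc (suc k))
      (λ j → θ (suc (suc (suc k))) * b (suc (suc k)) j - ι 3 * a (suc (suc k)) j)

-- Arcs of 𝒩ⁿ (internal nodes are the naturals 1..n):
--   sA j : s → j,   tA j : j → t,   mA i j : i → j  (arc exists iff i > j)

data Arc : Set where
  sA : ℕ → Arc
  tA : ℕ → Arc
  mA : ℕ → ℕ → Arc

ut : ℕ → ℕ → ℚ
ut zero          j = 0ℚ
ut (suc zero)    j = 1ℚ
ut (suc (suc m)) j =
  if j <ᵇ suc (suc m) then ut (suc m) j + θ (suc (suc m)) * b (suc m) j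
  else φ (suc (suc m)) ÷' ι 2

um : ℕ → ℕ → ℕ → ℚ
um zero          i j = 0ℚ
um (suc zero)    i j = 0ℚ
um (suc (suc m)) i j =
  if i <ᵇ suc (suc m) then um (suc m) i j
  else θ (suc (suc m)) * b (suc m) j - ι 3 * a (suc m) j

cap : ℕ → ℚ → ℚ → Arc → ℚ
cap n l m (sA j)   = a n j * l + b n j * m
cap n l m (tA j)   = ut n j
cap n l m (mA i j) = um n i j

-- Subsets of {1,…,n} are represented by Boolean predicates on ℕ.

addN : (ℕ → Bool) → ℕ → (ℕ → Bool)
addN S n j = S j ∨ (j ≡ᵇ n)

-- one step of the recursion for the points: from (λ^{n-1,S}, μ^{n-1,S})
-- to (λ^{n,S}, μ^{n,S}) (if n ∉ S) resp. (λ^{n,S+n}, μ^{n,S+n}) (if n ∈ S)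
pointStep : ℕ → Bool → ℚ × ℚ → ℚ × ℚ
pointStep n true  (l , μ) = ((l + ι 3) ÷' ι 4 , μ ÷' (1ℚ + θ n))
pointStep n false (l , μ) = (l ÷' ι 4 , (μ + θ n) ÷' (1ℚ + θ n))

-- the points (λ^{n,S}, μ^{n,S}); only depends on S ∩ {1,…,n}
point : ℕ → (ℕ → Bool) → ℚ × ℚ
point zero          S = 0ℚ , 0ℚ
point (suc zero)    S =
  if S 1 then (ι 3 ÷' ι 4 , ι 3 ÷' ι 4) else (1ℚ ÷' ι 4 , 1ℚ ÷' ι 4)
point (suc (suc m)) S = pointStep (suc (suc m)) (S (suc (suc m))) (point (suc m) S)

dd : ℕ → ℕ → ℚ
dd n j = θ n * b (n ∸ 1) j - ι 3 * a (n ∸ 1) j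

flowStep : ℕ → Bool → ℚ × ℚ → (Arc → ℚ) → Arc → ℚ
flowStep n true  p prev (sA j) =
  if j <ᵇ n then prev (sA j) + ι 3 * a (n ∸ 1) j
  else φ n ÷' ι 2 + sumR (n ∸ 1) (dd n)
flowStep n true  p prev (tA j) =
  if j <ᵇ n then prev (tA j) + θ n * b (n ∸ 1) j else φ n ÷' ι 2
flowStep n true  p prev (mA i j) = if i <ᵇ n then prev (mA i j) else dd n j
flowStep n false p prev (sA j) =
  if j <ᵇ n then prev (sA j) + θ n * b (n ∸ 1) j else φ n * proj₁ p + proj₂ p
flowStep n false p prev (tA j) =
  if j <ᵇ n then prev (tA j) + θ n * b (n ∸ 1) j else φ n * proj₁ p + proj₂ p
flowStep n false p prev (mA i j) = if i <ᵇ n then prev (mA i j) else 0ℚ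

flow : ℕ → (ℕ → Bool) → Arc → ℚ
flow zero          S e        = 0ℚ
flow (suc zero)    S (sA j)   = if S 1 then 1ℚ else 1ℚ ÷' ι 2
flow (suc zero)    S (tA j)   = if S 1 then 1ℚ else 1ℚ ÷' ι 2
flow (suc zero)    S (mA i j) = 0ℚ
flow (suc (suc m)) S e =
  flowStep (suc (suc m)) (S (suc (suc m))) (point (suc (suc m)) S) (flow (suc m) S) e

Feasible : ℕ → (Arc → ℚ) → (Arc → ℚ) → Set
Feasible n u x =
  (∀ j → 1 ℕ.≤ j → j ℕ.≤ n →
     (0ℚ ≤ x (sA j) × x (sA j) ≤ u (sA j)) × (0ℚ ≤ x (tA j) × x (tA j) ≤ u (tA j)))
  × (∀ i j → 1 ℕ.≤ j → j ℕ.< i → i ℕ.≤ n →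
       0ℚ ≤ x (mA i j) × x (mA i j) ≤ u (mA i j))
  × (∀ j → 1 ℕ.≤ j → j ℕ.≤ n →
       x (sA j) + sumR n (λ i → if j <ᵇ i then x (mA i j) else 0ℚ)
       ≡ x (tA j) + sumR n (λ k → if k <ᵇ j then x (mA j k) else 0ℚ))

SCS : ℕ → (Arc → ℚ) → (Arc → ℚ) → (ℕ → Bool) → Set
SCS n u x T =
  (∀ j → 1 ℕ.≤ j → j ℕ.≤ n → T j ≡ true →
     x (sA j) < u (sA j) × x (tA j) ≡ u (tA j))
  × (∀ j → 1 ℕ.≤ j → j ℕ.≤ n → T j ≡ false →
     x (sA j) ≡ u (sA j) × x (tA j) < u (tA j))
  × (∀ j k → 1 ℕ.≤ k → k ℕ.< j → j ℕ.≤ n → T j ≡ true → T k ≡ false →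
     x (mA j k) ≡ u (mA j k))
  × (∀ j k → 1 ℕ.≤ k → k ℕ.< j → j ℕ.≤ n → T j ≡ false → T k ≡ true →
     x (mA j k) ≡ 0ℚ)

-- capacity of the s–t cut {s} ∪ C (C ⊆ {1,…,n})
cutCap : ℕ → (Arc → ℚ) → (ℕ → Bool) → ℚ
cutCap n u C =
  sumR n (λ j → if C j then u (tA j) else u (sA j))
  + sumR n (λ j → sumR n (λ k →
      if (k <ᵇ j) ∧ C j ∧ not (C k) then u (mA j k) else 0ℚ))

UniqueMinCut : ℕ → (Arc → ℚ) → (ℕ → Bool) → Set
UniqueMinCut n u T =
  (∀ C → cutCap n u T ≤ cutCap n u C)
  × (∀ C → cutCap n u C ≡ cutCap n u T → ∀ j → 1 ℕ.≤ j → j ℕ.≤ n → C j ≡ T j)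

{-# OPTIONS --safe #-}
module Submission where

-- By induction on n, for every S the flow x^{n,S} is feasible and satisfies (SCS) with respect to S
-- at (λ^{n,S}, μ^{n,S}), and this point lies in (0,1)². Passing from 𝒩^{n-1} to 𝒩^n raises flow
-- and capacity of each old source arc by the same amount (3a^{n-1}_{sj} if n ∈ S, θⁿb^{n-1}_{sj}
-- otherwise) and of each old sink arc by θⁿb^{n-1}_{sj}, the new arc n → j carrying the difference,
-- so every old condition persists. At the new node the choice of (λ, μ) leaves the source arc
-- unsaturated if n ∈ S and the sink arc unsaturated if n ∉ S; this needs φⁿ ≥ 4 and
-- θⁿb^{n-1}_{sj} ≥ 3a^{n-1}_{sj}, which a separate induction on the coefficients provides.
--
-- (SCS) are complementary slackness conditions: the capacity of a cut {s} ∪ C is the flow value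
-- plus nonnegative slack terms, which all vanish for C = S + n and not all otherwise.

open import Defs
open import Data.Bool using (Bool; true; false; if_then_else_; _∧_; not)
import Data.Bool.Properties as BP
open import Data.Empty using (⊥-elim)
open import Data.List using ([]; _∷_)
open import Data.Nat as ℕ using (ℕ; zero; suc; _<ᵇ_; z≤n; s≤s)
import Data.Nat.Properties as NP
open import Data.Product using (_×_; _,_; proj₁; proj₂)
open import Data.Rational using (ℚ; 0ℚ; 1ℚ; _+_; _*_; _-_; _≤_; _<_; 1/_; ≢-nonZero; nonNegative; positive)
import Data.Rational.Properties as QP
open import Data.Rational.Properties using (_≟_)
open import Data.Sum using (inj₁; inj₂)
open import Function using (Equivalence; _∋_)
open import Level using (0ℓ)
open import Relation.Nullary using (yes; no; ¬_; contradiction)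
open import Relation.Nullary.Decidable using (dec⇒maybe; True; toWitness)
open import Relation.Binary.PropositionalEquality
open import Tactic.RingSolver using (solve-∀; solve)
open import Tactic.RingSolver.Core.AlmostCommutativeRing using (AlmostCommutativeRing; fromCommutativeRing)

ℚ-ring : AlmostCommutativeRing 0ℓ 0ℓ
ℚ-ring = fromCommutativeRing QP.+-*-commutativeRing (λ q → dec⇒maybe (0ℚ ≟ q))

≤-by-slack : ∀ {p q} d → 0ℚ ≤ d → q ≡ p + d → p ≤ q
≤-by-slack {p} d 0≤d refl = subst (_≤ p + d) (QP.+-identityʳ p) (QP.+-monoʳ-≤ p 0≤d)

<-by-slack : ∀ {p q} d → 0ℚ < d → q ≡ p + d → p < q
<-by-slack {p} d 0<d refl = subst (_< p + d) (QP.+-identityʳ p) (QP.+-monoʳ-< p 0<d)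

p≤q⇒0≤q-p : ∀ {p q} → p ≤ q → 0ℚ ≤ q - p
p≤q⇒0≤q-p {p} {q} h = subst (_≤ q - p) (QP.+-inverseʳ p) (QP.+-monoˡ-≤ (Data.Rational.-_ p) h)

p<q⇒0<q-p : ∀ {p q} → p < q → 0ℚ < q - p
p<q⇒0<q-p {p} {q} h = subst (_< q - p) (QP.+-inverseʳ p) (QP.+-monoˡ-< (Data.Rational.-_ p) h)

*-nonNeg : ∀ {p q} → 0ℚ ≤ p → 0ℚ ≤ q → 0ℚ ≤ p * q
*-nonNeg {p} {q} 0≤p 0≤q =
  QP.nonNegative⁻¹ (p * q) {{QP.nonNeg*nonNeg⇒nonNeg p {{nonNegative 0≤p}} q {{nonNegative 0≤q}}}}

*-pos : ∀ {p q} → 0ℚ < p → 0ℚ < q → 0ℚ < p * q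
*-pos {p} {q} 0<p 0<q =
  QP.positive⁻¹ (p * q) {{QP.pos*pos⇒pos p {{positive 0<p}} q {{positive 0<q}}}}

ι-nonNeg : ∀ k → 0ℚ ≤ ι k
ι-nonNeg k = QP.nonNegative⁻¹ (ι k) {{QP.normalize-nonNeg k 1}}

ι-pos : ∀ k → 0ℚ < ι (suc k)
ι-pos k = QP.positive⁻¹ (ι (suc k)) {{QP.normalize-pos (suc k) 1}}

pos⇒≢0 : ∀ {p} → 0ℚ < p → ¬ (p ≡ 0ℚ)
pos⇒≢0 0<p p≡0 = QP.<-irrefl (sym p≡0) 0<p

*-monoˡ-≤-0≤ : ∀ {r p q} → 0ℚ ≤ r → p ≤ q → r * p ≤ r * q
*-monoˡ-≤-0≤ {r} 0≤r = QP.*-monoˡ-≤-nonNeg r {{nonNegative 0≤r}}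

*-monoʳ-≤-0≤ : ∀ {r p q} → 0ℚ ≤ r → p ≤ q → p * r ≤ q * r
*-monoʳ-≤-0≤ {r} 0≤r = QP.*-monoʳ-≤-nonNeg r {{nonNegative 0≤r}}

p+q≤r⇒p≤r-q : ∀ {p q r} → p + q ≤ r → p ≤ r - q
p+q≤r⇒p≤r-q {p} {q} {r} h = subst (_≤ r - q) (cancel p q) (QP.+-monoˡ-≤ (Data.Rational.-_ q) h)
  where
  cancel : ∀ p q → p + q - q ≡ p
  cancel = solve-∀ ℚ-ring

0≤1 : 0ℚ ≤ 1ℚ
0≤1 = ι-nonNeg 1

decide-< : ∀ p q → {True (p QP.<? q)} → p < q
decide-< p q {p<q} = toWitness p<q

*-÷'-inverse : ∀ p q → ¬ (q ≡ 0ℚ) → q * (p ÷' q) ≡ p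
*-÷'-inverse p q q≢0 with q ≟ 0ℚ
... | yes q≡0 = ⊥-elim (q≢0 q≡0)
... | no q≢0' = begin
  q * (p * 1/ q)   ≡⟨ swap q p (1/ q) ⟩
  p * (q * 1/ q)   ≡⟨ cong (p *_) (QP.*-inverseʳ q) ⟩
  p * 1ℚ           ≡⟨ QP.*-identityʳ p ⟩
  p                ∎
  where
  open ≡-Reasoning
  instance _ = ≢-nonZero q≢0'
  swap : ∀ x y z → x * (y * z) ≡ y * (x * z)
  swap = solve-∀ ℚ-ring

if-true : ∀ {A : Set} {c : Bool} {x y : A} → c ≡ true → (if c then x else y) ≡ x
if-true refl = refl

if-false : ∀ {A : Set} {c : Bool} {x y : A} → c ≡ false → (if c then x else y) ≡ y
if-false refl = refl

<ᵇ-true : ∀ {j n} → j ℕ.< n → (j <ᵇ n) ≡ true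
<ᵇ-true j<n = Equivalence.to BP.T-≡ (NP.<⇒<ᵇ j<n)

<ᵇ-false : ∀ {j n} → n ℕ.≤ j → (j <ᵇ n) ≡ false
<ᵇ-false z≤n     = refl
<ᵇ-false (s≤s h) = <ᵇ-false h

<ᵇ⇒< : ∀ {j n} → (j <ᵇ n) ≡ true → j ℕ.< n
<ᵇ⇒< {j} {n} e = NP.<ᵇ⇒< j n (Equivalence.from BP.T-≡ e)

≤-suc-elim : ∀ {m} (P : ℕ → Set) → (∀ {j} → j ℕ.≤ m → P j) → P (suc m) →
             ∀ {j} → j ℕ.≤ suc m → P j
≤-suc-elim P below top j≤1+m with NP.m≤n⇒m<n∨m≡n j≤1+m
... | inj₁ j<1+m = below (NP.≤-pred j<1+m)
... | inj₂ refl  = top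

sumR-cong : ∀ m {f g : ℕ → ℚ} → (∀ i → 1 ℕ.≤ i → i ℕ.≤ m → f i ≡ g i) → sumR m f ≡ sumR m g
sumR-cong zero    f≗g = refl
sumR-cong (suc m) f≗g =
  cong₂ _+_ (sumR-cong m (λ i 1≤i i≤m → f≗g i 1≤i (NP.m≤n⇒m≤1+n i≤m)))
            (f≗g (suc m) (s≤s z≤n) NP.≤-refl)

sumR-zero : ∀ m {f : ℕ → ℚ} → (∀ i → 1 ℕ.≤ i → i ℕ.≤ m → f i ≡ 0ℚ) → sumR m f ≡ 0ℚ
sumR-zero zero    f≗0 = refl
sumR-zero (suc m) f≗0 =
  cong₂ _+_ (sumR-zero m (λ i 1≤i i≤m → f≗0 i 1≤i (NP.m≤n⇒m≤1+n i≤m)))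
            (f≗0 (suc m) (s≤s z≤n) NP.≤-refl)

sumR-nonNeg : ∀ m {f : ℕ → ℚ} → (∀ i → 1 ℕ.≤ i → i ℕ.≤ m → 0ℚ ≤ f i) → 0ℚ ≤ sumR m f
sumR-nonNeg zero    0≤f = QP.≤-refl
sumR-nonNeg (suc m) 0≤f =
  QP.+-mono-≤ (sumR-nonNeg m (λ i 1≤i i≤m → 0≤f i 1≤i (NP.m≤n⇒m≤1+n i≤m)))
              (0≤f (suc m) (s≤s z≤n) NP.≤-refl)

term≤sumR : ∀ m {f : ℕ → ℚ} → (∀ i → 1 ℕ.≤ i → i ℕ.≤ m → 0ℚ ≤ f i) →
            ∀ j → 1 ℕ.≤ j → j ℕ.≤ m → f j ≤ sumR m f
term≤sumR zero    0≤f (suc j) (s≤s z≤n) ()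
term≤sumR (suc m) {f} 0≤f j 1≤j j≤1+m =
  ≤-suc-elim (λ j → 1 ℕ.≤ j → f j ≤ sumR (suc m) f)
    (λ j≤m 1≤j → QP.≤-trans (term≤sumR m 0≤f′ _ 1≤j j≤m)
                            (≤-by-slack (f (suc m)) (0≤f (suc m) (s≤s z≤n) NP.≤-refl) refl))
    (λ _ → ≤-by-slack (sumR m f) (sumR-nonNeg m 0≤f′) (QP.+-comm (sumR m f) (f (suc m))))
    j≤1+m 1≤j
  where
  0≤f′ : ∀ i → 1 ℕ.≤ i → i ℕ.≤ m → 0ℚ ≤ f i
  0≤f′ i 1≤i i≤m = 0≤f i 1≤i (NP.m≤n⇒m≤1+n i≤m)

sumR-+ : ∀ m (f g : ℕ → ℚ) → sumR m (λ i → f i + g i) ≡ sumR m f + sumR m g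
sumR-+ zero    f g = sym (QP.+-identityʳ 0ℚ)
sumR-+ (suc m) f g = trans (cong (_+ (f (suc m) + g (suc m))) (sumR-+ m f g))
                           (interchange (sumR m f) (sumR m g) (f (suc m)) (g (suc m)))
  where
  interchange : ∀ a b c d → (a + b) + (c + d) ≡ (a + c) + (b + d)
  interchange = solve-∀ ℚ-ring

sumR-- : ∀ m (f g : ℕ → ℚ) → sumR m (λ i → f i - g i) ≡ sumR m f - sumR m g
sumR-- zero    f g = refl
sumR-- (suc m) f g = trans (cong (_+ (f (suc m) - g (suc m))) (sumR-- m f g))
                           (interchange (sumR m f) (sumR m g) (f (suc m)) (g (suc m)))
  where
  interchange : ∀ a b c d → (a - b) + (c - d) ≡ (a + c) - (b + d)
  interchange = solve-∀ ℚ-ring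

sumR-comm : ∀ m p (F : ℕ → ℕ → ℚ) →
  sumR m (λ i → sumR p (λ j → F i j)) ≡ sumR p (λ j → sumR m (λ i → F i j))
sumR-comm zero    p F = sym (sumR-zero p (λ _ _ _ → refl))
sumR-comm (suc m) p F =
  trans (cong (_+ sumR p (F (suc m))) (sumR-comm m p F))
        (sym (sumR-+ p (λ j → sumR m (λ i → F i j)) (F (suc m))))

when : Bool → ℚ → ℚ
when c q = if c then q else 0ℚ

sumR-when : ∀ m c (f : ℕ → ℚ) → sumR m (λ k → when c (f k)) ≡ when c (sumR m f)
sumR-when m true  f = refl
sumR-when m false f = sumR-zero m (λ _ _ _ → refl)

sumR-when-transfer : ∀ m (C : ℕ → Bool) (X : ℕ → ℕ → ℚ) →
  sumR m (λ j → sumR m (λ k → when (C j) (X j k) - when (C k) (X j k)))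
  ≡ sumR m (λ j → when (C j) (sumR m (X j))) - sumR m (λ k → when (C k) (sumR m (λ j → X j k)))
sumR-when-transfer m C X = begin
  sumR m (λ j → sumR m (λ k → when (C j) (X j k) - when (C k) (X j k)))
    ≡⟨ sumR-cong m (λ j _ _ → sumR-- m (λ k → when (C j) (X j k)) (λ k → when (C k) (X j k))) ⟩
  sumR m (λ j → sumR m (λ k → when (C j) (X j k)) - sumR m (λ k → when (C k) (X j k)))
    ≡⟨ sumR-- m _ _ ⟩
  sumR m (λ j → sumR m (λ k → when (C j) (X j k))) - sumR m (λ j → sumR m (λ k → when (C k) (X j k)))
    ≡⟨ cong₂ _-_ (sumR-cong m (λ j _ _ → sumR-when m (C j) (X j))) (sumR-comm m m _) ⟩
  sumR m (λ j → when (C j) (sumR m (X j))) - sumR m (λ k → sumR m (λ j → when (C k) (X j k)))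
    ≡⟨ cong (sumR m (λ j → when (C j) (sumR m (X j))) -_)
            (sumR-cong m (λ k _ _ → sumR-when m (C k) (λ j → X j k))) ⟩
  sumR m (λ j → when (C j) (sumR m (X j))) - sumR m (λ k → when (C k) (sumR m (λ j → X j k))) ∎
  where open ≡-Reasoning

sumR-when-cancel : ∀ m (C : ℕ → Bool) (A B : ℕ → ℚ) →
  sumR m (λ j → when (C j) (A j - B j)) + (sumR m (λ j → when (C j) (B j)) - sumR m (λ j → when (C j) (A j)))
  ≡ 0ℚ
sumR-when-cancel m C A B = begin
  sumR m (λ j → when (C j) (A j - B j)) + (sumR m (λ j → when (C j) (B j)) - sumR m (λ j → when (C j) (A j)))
    ≡⟨ reassoc (sumR m (λ j → when (C j) (A j - B j))) _ _ ⟩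
  (sumR m (λ j → when (C j) (A j - B j)) + sumR m (λ j → when (C j) (B j))) - sumR m (λ j → when (C j) (A j))
    ≡⟨ cong (_- sumR m (λ j → when (C j) (A j))) (sym (sumR-+ m _ _)) ⟩
  sumR m (λ j → when (C j) (A j - B j) + when (C j) (B j)) - sumR m (λ j → when (C j) (A j))
    ≡⟨ cong (_- sumR m (λ j → when (C j) (A j))) (sumR-cong m (λ j _ _ → pointwise (C j) (A j) (B j))) ⟩
  sumR m (λ j → when (C j) (A j)) - sumR m (λ j → when (C j) (A j))
    ≡⟨ QP.+-inverseʳ (sumR m (λ j → when (C j) (A j))) ⟩
  0ℚ ∎
  where
  open ≡-Reasoning
  reassoc : ∀ a b c → a + (b - c) ≡ (a + b) - c
  reassoc = solve-∀ ℚ-ring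
  pointwise : ∀ c a b → when c (a - b) + when c b ≡ when c a
  pointwise true  a b = ((a - b) + b ≡ a) ∋ solve (a ∷ b ∷ []) ℚ-ring
  pointwise false a b = refl

pairSlack : Bool → Bool → ℚ → ℚ → ℚ
pairSlack true  false capacity flow = capacity - flow
pairSlack false true  capacity flow = flow
pairSlack true  true  capacity flow = 0ℚ
pairSlack false false capacity flow = 0ℚ

node-cut-identity : ∀ c us ut xs xt A B → xs + A ≡ xt + B →
  (if c then ut else us) ≡ (xs + (if c then ut - xt else us - xs)) + when c (A - B)
node-cut-identity false us ut xs xt A B _ = (us ≡ (xs + (us - xs)) + 0ℚ) ∋ solve (us ∷ xs ∷ []) ℚ-ring
node-cut-identity true  us ut xs xt A B conserved = begin
  ut                                        ≡⟨ solve (ut ∷ xs ∷ xt ∷ B ∷ []) ℚ-ring ⟩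
  (xs + (ut - xt)) + ((xt + B) - xs - B)    ≡⟨ cong (λ w → (xs + (ut - xt)) + (w - xs - B)) (sym conserved) ⟩
  (xs + (ut - xt)) + ((xs + A) - xs - B)    ≡⟨ cong ((xs + (ut - xt)) +_) (solve (xs ∷ A ∷ B ∷ []) ℚ-ring) ⟩
  (xs + (ut - xt)) + (A - B)                ∎
  where open ≡-Reasoning

arc-cut-identity : ∀ b cj ck U X →
  when (b ∧ cj ∧ not ck) U ≡ when b (pairSlack cj ck U X) + (when cj (when b X) - when ck (when b X))
arc-cut-identity false cj    ck    U X = sym (cong₂ (λ p q → 0ℚ + (p - q)) (when-0 cj) (when-0 ck))
  where
  when-0 : ∀ c → when c 0ℚ ≡ 0ℚ
  when-0 true  = refl
  when-0 false = refl
arc-cut-identity true  true  true  U X = (0ℚ ≡ 0ℚ + (X - X)) ∋ solve (X ∷ []) ℚ-ring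
arc-cut-identity true  true  false U X = (U ≡ (U - X) + (X - 0ℚ)) ∋ solve (U ∷ X ∷ []) ℚ-ring
arc-cut-identity true  false true  U X = (0ℚ ≡ X + (0ℚ - X)) ∋ solve (X ∷ []) ℚ-ring
arc-cut-identity true  false false U X = refl

pairSlack-nonNeg : ∀ cj ck {U X} → 0ℚ ≤ X × X ≤ U → 0ℚ ≤ pairSlack cj ck U X
pairSlack-nonNeg true  false (_ , X≤U) = p≤q⇒0≤q-p X≤U
pairSlack-nonNeg false true  (0≤X , _) = 0≤X
pairSlack-nonNeg true  true  _         = QP.≤-refl
pairSlack-nonNeg false false _         = QP.≤-refl

module MinCut (n : ℕ) (u x : Arc → ℚ) where

  transfer : ℕ → ℕ → ℚ
  transfer j k = when (k <ᵇ j) (x (mA j k))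

  inflow outflow : ℕ → ℚ
  inflow  j = sumR n (λ i → transfer i j)
  outflow j = sumR n (transfer j)

  value : ℚ
  value = sumR n (λ j → x (sA j))

  nodeSlack : (ℕ → Bool) → ℕ → ℚ
  nodeSlack C j = if C j then u (tA j) - x (tA j) else u (sA j) - x (sA j)

  arcSlack : (ℕ → Bool) → ℕ → ℕ → ℚ
  arcSlack C j k = when (k <ᵇ j) (pairSlack (C j) (C k) (u (mA j k)) (x (mA j k)))

  slack : (ℕ → Bool) → ℚ
  slack C = sumR n (nodeSlack C) + sumR n (λ j → sumR n (arcSlack C j))

  cutCap≡value+slack : (∀ j → 1 ℕ.≤ j → j ℕ.≤ n → x (sA j) + inflow j ≡ x (tA j) + outflow j) →
    ∀ C → cutCap n u C ≡ value + slack C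
  cutCap≡value+slack conserved C = begin
    cutCap n u C
      ≡⟨ cong₂ _+_
           (sumR-cong n (λ j 1≤j j≤n →
              node-cut-identity (C j) (u (sA j)) (u (tA j)) (x (sA j)) (x (tA j)) (inflow j) (outflow j)
                                (conserved j 1≤j j≤n)))
           (sumR-cong n (λ j _ _ → sumR-cong n (λ k _ _ →
              arc-cut-identity (k <ᵇ j) (C j) (C k) (u (mA j k)) (x (mA j k))))) ⟩
    sumR n (λ j → (x (sA j) + nodeSlack C j) + when (C j) (inflow j - outflow j))
    + sumR n (λ j → sumR n (λ k → arcSlack C j k + (when (C j) (transfer j k) - when (C k) (transfer j k))))
      ≡⟨ cong₂ _+_
           (trans (sumR-+ n _ _) (cong (_+ N) (sumR-+ n _ _)))
           (trans (sumR-cong n (λ j _ _ → sumR-+ n (arcSlack C j) _)) (sumR-+ n _ _)) ⟩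
    ((value + sumR n (nodeSlack C)) + N)
    + (sumR n (λ j → sumR n (arcSlack C j))
       + sumR n (λ j → sumR n (λ k → when (C j) (transfer j k) - when (C k) (transfer j k))))
      ≡⟨ cong (λ w → ((value + sumR n (nodeSlack C)) + N) + (sumR n (λ j → sumR n (arcSlack C j)) + w))
              (sumR-when-transfer n C transfer) ⟩
    ((value + sumR n (nodeSlack C)) + N) + (sumR n (λ j → sumR n (arcSlack C j)) + M)
      ≡⟨ regroup value (sumR n (nodeSlack C)) N (sumR n (λ j → sumR n (arcSlack C j))) M ⟩
    (value + slack C) + (N + M)
      ≡⟨ cong ((value + slack C) +_) (sumR-when-cancel n C inflow outflow) ⟩
    (value + slack C) + 0ℚ
      ≡⟨ QP.+-identityʳ (value + slack C) ⟩
    value + slack C ∎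
    where
    open ≡-Reasoning
    N M : ℚ
    N = sumR n (λ j → when (C j) (inflow j - outflow j))
    M = sumR n (λ j → when (C j) (outflow j)) - sumR n (λ j → when (C j) (inflow j))
    regroup : ∀ v s N a M → ((v + s) + N) + (a + M) ≡ (v + (s + a)) + (N + M)
    regroup = solve-∀ ℚ-ring

  module _ (feasible : Feasible n u x) where

    nodeSlack-nonNeg : ∀ C j → 1 ℕ.≤ j → j ℕ.≤ n → 0ℚ ≤ nodeSlack C j
    nodeSlack-nonNeg C j 1≤j j≤n with C j
    ... | true  = p≤q⇒0≤q-p (proj₂ (proj₂ (proj₁ feasible j 1≤j j≤n)))
    ... | false = p≤q⇒0≤q-p (proj₂ (proj₁ (proj₁ feasible j 1≤j j≤n)))

    arcSlack-nonNeg : ∀ C j k → 1 ℕ.≤ k → j ℕ.≤ n → 0ℚ ≤ arcSlack C j k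
    arcSlack-nonNeg C j k 1≤k j≤n with k <ᵇ j in k<ᵇj
    ... | false = QP.≤-refl
    ... | true  = pairSlack-nonNeg (C j) (C k) (proj₁ (proj₂ feasible) j k 1≤k (<ᵇ⇒< k<ᵇj) j≤n)

    arcSlacks-nonNeg : ∀ C → 0ℚ ≤ sumR n (λ j → sumR n (arcSlack C j))
    arcSlacks-nonNeg C =
      sumR-nonNeg n (λ j _ j≤n → sumR-nonNeg n (λ k 1≤k _ → arcSlack-nonNeg C j k 1≤k j≤n))

    slack-nonNeg : ∀ C → 0ℚ ≤ slack C
    slack-nonNeg C = QP.+-mono-≤ (sumR-nonNeg n (nodeSlack-nonNeg C)) (arcSlacks-nonNeg C)

    module _ {T : ℕ → Bool} (scs : SCS n u x T) where

      nodeSlack-T≡0 : ∀ j → 1 ℕ.≤ j → j ℕ.≤ n → nodeSlack T j ≡ 0ℚ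
      nodeSlack-T≡0 j 1≤j j≤n with T j in Tj
      ... | true  = trans (cong (u (tA j) -_) (proj₂ (proj₁ scs j 1≤j j≤n Tj))) (QP.+-inverseʳ (u (tA j)))
      ... | false = trans (cong (u (sA j) -_) (proj₁ (proj₁ (proj₂ scs) j 1≤j j≤n Tj))) (QP.+-inverseʳ (u (sA j)))

      arcSlack-T≡0 : ∀ j k → 1 ℕ.≤ k → j ℕ.≤ n → arcSlack T j k ≡ 0ℚ
      arcSlack-T≡0 j k 1≤k j≤n with k <ᵇ j in k<ᵇj | T j in Tj | T k in Tk
      ... | false | _     | _     = refl
      ... | true  | true  | true  = refl
      ... | true  | false | false = refl
      ... | true  | true  | false =
        trans (cong (u (mA j k) -_) (proj₁ (proj₂ (proj₂ scs)) j k 1≤k (<ᵇ⇒< k<ᵇj) j≤n Tj Tk))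
              (QP.+-inverseʳ (u (mA j k)))
      ... | true  | false | true  = proj₂ (proj₂ (proj₂ scs)) j k 1≤k (<ᵇ⇒< k<ᵇj) j≤n Tj Tk

      slack-T≡0 : slack T ≡ 0ℚ
      slack-T≡0 = cong₂ _+_ (sumR-zero n nodeSlack-T≡0)
        (sumR-zero n (λ j _ j≤n → sumR-zero n (λ k 1≤k _ → arcSlack-T≡0 j k 1≤k j≤n)))

      nodeSlack-pos : ∀ C j → 1 ℕ.≤ j → j ℕ.≤ n → ¬ (C j ≡ T j) → 0ℚ < nodeSlack C j
      nodeSlack-pos C j 1≤j j≤n Cj≢Tj with C j | T j in Tj
      ... | true  | true  = ⊥-elim (Cj≢Tj refl)
      ... | false | false = ⊥-elim (Cj≢Tj refl)
      ... | true  | false = p<q⇒0<q-p (proj₂ (proj₁ (proj₂ scs) j 1≤j j≤n Tj))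
      ... | false | true  = p<q⇒0<q-p (proj₁ (proj₁ scs j 1≤j j≤n Tj))

      slack-pos : ∀ C j → 1 ℕ.≤ j → j ℕ.≤ n → ¬ (C j ≡ T j) → 0ℚ < slack C
      slack-pos C j 1≤j j≤n Cj≢Tj =
        QP.+-mono-<-≤ (QP.<-≤-trans (nodeSlack-pos C j 1≤j j≤n Cj≢Tj)
                                     (term≤sumR n (nodeSlack-nonNeg C) j 1≤j j≤n))
                      (arcSlacks-nonNeg C)

uniqueMinCut : ∀ {n u x T} → Feasible n u x → SCS n u x T → UniqueMinCut n u T
uniqueMinCut {n} {u} {x} {T} feasible scs = minimal , unique
  where
  open MinCut n u x
  cutCap-T : cutCap n u T ≡ value
  cutCap-T = begin
    cutCap n u T        ≡⟨ cutCap≡value+slack (proj₂ (proj₂ feasible)) T ⟩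
    value + slack T     ≡⟨ cong (value +_) (slack-T≡0 feasible scs) ⟩
    value + 0ℚ          ≡⟨ QP.+-identityʳ value ⟩
    value               ∎
    where open ≡-Reasoning

  cutCap-C : ∀ C → cutCap n u C ≡ cutCap n u T + slack C
  cutCap-C C = trans (cutCap≡value+slack (proj₂ (proj₂ feasible)) C) (cong (_+ slack C) (sym cutCap-T))

  minimal : ∀ C → cutCap n u T ≤ cutCap n u C
  minimal C = ≤-by-slack (slack C) (slack-nonNeg feasible C) (cutCap-C C)

  unique : ∀ C → cutCap n u C ≡ cutCap n u T → ∀ j → 1 ℕ.≤ j → j ℕ.≤ n → C j ≡ T j
  unique C same j 1≤j j≤n with C j BP.≟ T j
  ... | yes Cj≡Tj = Cj≡Tj
  ... | no  Cj≢Tj = ⊥-elim (QP.<-irrefl (sym same)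
                      (<-by-slack (slack C) (slack-pos feasible scs C j 1≤j j≤n Cj≢Tj) (cutCap-C C)))

a-old : ∀ {k j} → j ℕ.< suc (suc k) → a (suc (suc k)) j ≡ ι 4 * a (suc k) j
a-old j<n = if-true (<ᵇ-true j<n)

a-new : ∀ k → a (suc (suc k)) (suc (suc k)) ≡ φ (suc (suc k))
a-new k = if-false (<ᵇ-false (NP.≤-refl {suc (suc k)}))

b-old : ∀ {k j} → j ℕ.< suc (suc k) → b (suc (suc k)) j ≡ (1ℚ + θ (suc (suc k))) * b (suc k) j
b-old j<n = if-true (<ᵇ-true j<n)

b-new : ∀ k → b (suc (suc k)) (suc (suc k)) ≡ 1ℚ
b-new k = if-false (<ᵇ-false (NP.≤-refl {suc (suc k)}))

record CoefficientBounds (m : ℕ) : Set where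
  field
    a-nonNeg     : ∀ j → 1 ℕ.≤ j → j ℕ.≤ m → 0ℚ ≤ a m j
    b≥1          : ∀ j → 1 ℕ.≤ j → j ℕ.≤ m → 1ℚ ≤ b m j
    -- the margin 4 is what yields φ (suc m) ≥ 4
    a+4≤a-diag*b : ∀ j → 1 ℕ.≤ j → j ℕ.< m → ι 4 + a m j ≤ a m m * b m j

  a≤a-diag*b : ∀ j → 1 ℕ.≤ j → j ℕ.≤ m → a m j ≤ a m m * b m j
  a≤a-diag*b j 1≤j j≤m with NP.m≤n⇒m<n∨m≡n j≤m
  ... | inj₁ j<m  = QP.≤-trans (≤-by-slack (ι 4) (ι-nonNeg 4) (QP.+-comm (ι 4) (a m j))) (a+4≤a-diag*b j 1≤j j<m)
  ... | inj₂ refl = begin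
    a m m          ≡⟨ QP.*-identityʳ (a m m) ⟨
    a m m * 1ℚ     ≤⟨ *-monoˡ-≤-0≤ (a-nonNeg m 1≤j j≤m) (b≥1 m 1≤j j≤m) ⟩
    a m m * b m m  ∎
    where open QP.≤-Reasoning

open CoefficientBounds

coefficientBounds-1 : CoefficientBounds 1
coefficientBounds-1 = record
  { a-nonNeg     = λ _ _ _ → 0≤1
  ; b≥1          = λ _ _ _ → QP.≤-refl
  ; a+4≤a-diag*b = λ { j (s≤s z≤n) (s≤s ()) }
  }

dd≡3[a-diag*b-a] : ∀ m j → dd (suc m) j ≡ ι 3 * (a m m * b m j - a m j)
dd≡3[a-diag*b-a] m j = factor (a m m) (b m j) (a m j)
  where
  factor : ∀ c B A → (ι 3 * c) * B - ι 3 * A ≡ ι 3 * (c * B - A)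
  factor = solve-∀ ℚ-ring

dd-nonNeg : ∀ {m} → CoefficientBounds m → ∀ j → 1 ℕ.≤ j → j ℕ.≤ m → 0ℚ ≤ dd (suc m) j
dd-nonNeg {m} bounds j 1≤j j≤m =
  subst (0ℚ ≤_) (sym (dd≡3[a-diag*b-a] m j))
    (*-nonNeg (ι-nonNeg 3) (p≤q⇒0≤q-p (a≤a-diag*b bounds j 1≤j j≤m)))

1≤dd-1 : ∀ {m} → CoefficientBounds m → 1 ℕ.< m → 1ℚ ≤ dd (suc m) 1
1≤dd-1 {m} bounds 1<m = begin
  1ℚ                                 ≤⟨ QP.≤ᵇ⇒≤ _ ⟩
  ι 3 * ι 4                          ≤⟨ *-monoˡ-≤-0≤ (ι-nonNeg 3)
                                          (p+q≤r⇒p≤r-q (a+4≤a-diag*b bounds 1 NP.≤-refl 1<m)) ⟩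
  ι 3 * (a m m * b m 1 - a m 1)      ≡⟨ dd≡3[a-diag*b-a] m 1 ⟨
  dd (suc m) 1                       ∎
  where open QP.≤-Reasoning

1≤[1+3c]*B : ∀ {c B} → 0ℚ ≤ c → 1ℚ ≤ B → 1ℚ ≤ (1ℚ + ι 3 * c) * B
1≤[1+3c]*B {c} {B} 0≤c 1≤B = begin
  1ℚ                  ≤⟨ 1≤B ⟩
  B                   ≡⟨ QP.*-identityˡ B ⟨
  1ℚ * B              ≤⟨ *-monoʳ-≤-0≤ (QP.≤-trans 0≤1 1≤B)
                           (≤-by-slack {1ℚ} (ι 3 * c) (*-nonNeg (ι-nonNeg 3) 0≤c) refl) ⟩
  (1ℚ + ι 3 * c) * B  ∎
  where open QP.≤-Reasoning

4+4A≤P*[[1+3c]*B] : ∀ {c B A P} → 0ℚ ≤ c → 1ℚ ≤ B → A ≤ c * B → ι 4 ≤ P →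
                    ι 4 + ι 4 * A ≤ P * ((1ℚ + ι 3 * c) * B)
4+4A≤P*[[1+3c]*B] {c} {B} {A} {P} 0≤c 1≤B A≤cB 4≤P = begin
  ι 4 + ι 4 * A
    ≤⟨ QP.+-monoʳ-≤ (ι 4) (*-monoˡ-≤-0≤ (ι-nonNeg 4) A≤cB) ⟩
  ι 4 + ι 4 * (c * B)
    ≤⟨ QP.+-monoˡ-≤ (ι 4 * (c * B)) (*-monoˡ-≤-0≤ (ι-nonNeg 4) 1≤B) ⟩
  ι 4 * B + ι 4 * (c * B)
    ≤⟨ ≤-by-slack (ι 8 * (c * B)) (*-nonNeg (ι-nonNeg 8) (*-nonNeg 0≤c 0≤B)) refl ⟩
  (ι 4 * B + ι 4 * (c * B)) + ι 8 * (c * B)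
    ≡⟨ expand c B ⟩
  ι 4 * ((1ℚ + ι 3 * c) * B)
    ≤⟨ *-monoʳ-≤-0≤ (QP.≤-trans 0≤1 (1≤[1+3c]*B 0≤c 1≤B)) 4≤P ⟩
  P * ((1ℚ + ι 3 * c) * B)
    ∎
  where
  open QP.≤-Reasoning
  0≤B : 0ℚ ≤ B
  0≤B = QP.≤-trans 0≤1 1≤B
  expand : ∀ c B → (ι 4 * B + ι 4 * (c * B)) + ι 8 * (c * B) ≡ ι 4 * ((1ℚ + ι 3 * c) * B)
  expand = solve-∀ ℚ-ring

coefficientBounds-step : ∀ k → CoefficientBounds (suc k) → ι 4 ≤ φ (suc (suc k)) →
                         CoefficientBounds (suc (suc k))
coefficientBounds-step k bounds 4≤φ = record
  { a-nonNeg     = λ j 1≤j j≤n →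
      ≤-suc-elim (λ j → 1 ℕ.≤ j → 0ℚ ≤ a n j) a-old-nonNeg a-new-nonNeg j≤n 1≤j
  ; b≥1          = λ j 1≤j j≤n →
      ≤-suc-elim (λ j → 1 ℕ.≤ j → 1ℚ ≤ b n j) b-old≥1 b-new≥1 j≤n 1≤j
  ; a+4≤a-diag*b = gap
  }
  where
  m n : ℕ
  m = suc k
  n = suc m
  0≤c : 0ℚ ≤ a m m
  0≤c = a-nonNeg bounds m (s≤s z≤n) NP.≤-refl
  a-old-nonNeg : ∀ {j} → j ℕ.≤ m → 1 ℕ.≤ j → 0ℚ ≤ a n j
  a-old-nonNeg {j} j≤m 1≤j =
    subst (0ℚ ≤_) (sym (a-old (s≤s j≤m))) (*-nonNeg (ι-nonNeg 4) (a-nonNeg bounds j 1≤j j≤m))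
  a-new-nonNeg : 1 ℕ.≤ n → 0ℚ ≤ a n n
  a-new-nonNeg _ = subst (0ℚ ≤_) (sym (a-new k)) (QP.≤-trans (ι-nonNeg 4) 4≤φ)
  b-old≥1 : ∀ {j} → j ℕ.≤ m → 1 ℕ.≤ j → 1ℚ ≤ b n j
  b-old≥1 {j} j≤m 1≤j = subst (1ℚ ≤_) (sym (b-old (s≤s j≤m))) (1≤[1+3c]*B 0≤c (b≥1 bounds j 1≤j j≤m))
  b-new≥1 : 1 ℕ.≤ n → 1ℚ ≤ b n n
  b-new≥1 _ = subst (1ℚ ≤_) (sym (b-new k)) QP.≤-refl
  gap : ∀ j → 1 ℕ.≤ j → j ℕ.< n → ι 4 + a n j ≤ a n n * b n j
  gap j 1≤j j<n =
    subst₂ _≤_ (cong (ι 4 +_) (sym (a-old j<n))) (sym (cong₂ _*_ (a-new k) (b-old j<n)))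
      (4+4A≤P*[[1+3c]*B] 0≤c (b≥1 bounds j 1≤j (NP.≤-pred j<n))
                             (a≤a-diag*b bounds j 1≤j (NP.≤-pred j<n)) 4≤φ)

coefficientBounds : ∀ k → CoefficientBounds (suc k) × ι 4 ≤ φ (suc (suc k))
coefficientBounds zero    = coefficientBounds-1 , QP.≤-refl
coefficientBounds (suc k) = next , 4≤φ
  where
  next : CoefficientBounds (suc (suc k))
  next = coefficientBounds-step k (proj₁ (coefficientBounds k)) (proj₂ (coefficientBounds k))
  4≤φ : ι 4 ≤ φ (suc (suc (suc k)))
  4≤φ = begin
    ι 4 * 1ℚ
      ≤⟨ *-monoˡ-≤-0≤ (ι-nonNeg 4) (1≤dd-1 next (s≤s (s≤s z≤n))) ⟩
    ι 4 * dd (suc (suc (suc k))) 1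
      ≤⟨ *-monoˡ-≤-0≤ (ι-nonNeg 4) (term≤sumR (suc (suc k)) (dd-nonNeg next) 1 NP.≤-refl (s≤s z≤n)) ⟩
    ι 4 * sumR (suc (suc k)) (dd (suc (suc (suc k))))
      ∎
    where open QP.≤-Reasoning

-- Equality for n > 2; for n = 2 the sum is dd 2 1 = 0 while φ 2 = 4.
ι4*sumR-dd≤φ : ∀ k → ι 4 * sumR (suc k) (dd (suc (suc k))) ≤ φ (suc (suc k))
ι4*sumR-dd≤φ zero    = QP.≤ᵇ⇒≤ _
ι4*sumR-dd≤φ (suc k) = QP.≤-refl

source-arc-unsaturated : ∀ {P s h L M l} → ι 4 * s ≤ P → 0ℚ < P → ι 2 * h ≡ P → ι 4 * L ≡ l + ι 3 →
                      0ℚ < l → 0ℚ ≤ M → h + s < P * L + M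
source-arc-unsaturated {P} {s} {h} {L} {M} {l} 4s≤P 0<P 2h≡P 4L≡l+3 0<l 0≤M =
  QP.*-cancelˡ-<-nonNeg (ι 4) {{nonNegative (ι-nonNeg 4)}} (begin-strict
    ι 4 * (h + s)                ≡⟨ expand h s ⟩
    ι 2 * (ι 2 * h) + ι 4 * s    ≡⟨ cong (λ w → ι 2 * w + ι 4 * s) 2h≡P ⟩
    ι 2 * P + ι 4 * s            ≤⟨ QP.+-monoʳ-≤ (ι 2 * P) 4s≤P ⟩
    ι 2 * P + P                  <⟨ <-by-slack (P * l + ι 4 * M)
                                      (QP.+-mono-<-≤ (*-pos 0<P 0<l) (*-nonNeg (ι-nonNeg 4) 0≤M)) (regroup P l M) ⟩
    P * (l + ι 3) + ι 4 * M      ≡⟨ cong (λ w → P * w + ι 4 * M) 4L≡l+3 ⟨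
    P * (ι 4 * L) + ι 4 * M      ≡⟨ factor P L M ⟩
    ι 4 * (P * L + M)            ∎)
  where
  open QP.≤-Reasoning
  expand : ∀ h s → ι 4 * (h + s) ≡ ι 2 * (ι 2 * h) + ι 4 * s
  expand = solve-∀ ℚ-ring
  regroup : ∀ P l M → P * (l + ι 3) + ι 4 * M ≡ (ι 2 * P + P) + (P * l + ι 4 * M)
  regroup = solve-∀ ℚ-ring
  factor : ∀ P L M → P * (ι 4 * L) + ι 4 * M ≡ ι 4 * (P * L + M)
  factor = solve-∀ ℚ-ring

sink-arc-unsaturated : ∀ {P h L M l} → ι 4 ≤ P → ι 2 * h ≡ P → ι 4 * L ≡ l → l < 1ℚ → M < 1ℚ →
                        P * L + M < h
sink-arc-unsaturated {P} {h} {L} {M} {l} 4≤P 2h≡P 4L≡l l<1 M<1 =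
  QP.*-cancelˡ-<-nonNeg (ι 8) {{nonNegative (ι-nonNeg 8)}} (begin-strict
    ι 8 * (P * L + M)                ≡⟨ expand P L M ⟩
    ι 2 * P * (ι 4 * L) + ι 8 * M    ≡⟨ cong (λ w → ι 2 * P * w + ι 8 * M) 4L≡l ⟩
    ι 2 * P * l + ι 8 * M            <⟨ QP.+-mono-≤-< (*-monoˡ-≤-0≤ (*-nonNeg (ι-nonNeg 2) 0≤P) (QP.<⇒≤ l<1))
                                                      (QP.*-monoʳ-<-pos (ι 8) {{positive (ι-pos 7)}} M<1) ⟩
    ι 2 * P * 1ℚ + ι 8 * 1ℚ          ≤⟨ QP.+-monoʳ-≤ (ι 2 * P * 1ℚ) (*-monoˡ-≤-0≤ (ι-nonNeg 2) 4≤P) ⟩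
    ι 2 * P * 1ℚ + ι 2 * P           ≡⟨ regroup P ⟩
    ι 4 * P                          ≡⟨ cong (ι 4 *_) 2h≡P ⟨
    ι 4 * (ι 2 * h)                  ≡⟨ solve (h ∷ []) ℚ-ring ⟩
    ι 8 * h                          ∎)
  where
  open QP.≤-Reasoning
  0≤P : 0ℚ ≤ P
  0≤P = QP.≤-trans (ι-nonNeg 4) 4≤P
  expand : ∀ P L M → ι 8 * (P * L + M) ≡ ι 2 * P * (ι 4 * L) + ι 8 * M
  expand = solve-∀ ℚ-ring
  regroup : ∀ P → ι 2 * P * 1ℚ + ι 2 * P ≡ ι 4 * P
  regroup = solve-∀ ℚ-ring

record NodeSCS (u x : Arc → ℚ) (T : ℕ → Bool) (j : ℕ) : Set where
  field
    in-T     : T j ≡ true → x (sA j) < u (sA j) × x (tA j) ≡ u (tA j)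
    out-T    : T j ≡ false → x (sA j) ≡ u (sA j) × x (tA j) < u (tA j)
    leaving  : ∀ k → 1 ℕ.≤ k → k ℕ.< j → T j ≡ true → T k ≡ false → x (mA j k) ≡ u (mA j k)
    entering : ∀ k → 1 ℕ.≤ k → k ℕ.< j → T j ≡ false → T k ≡ true → x (mA j k) ≡ 0ℚ

SCS⇒NodeSCS : ∀ {n u x T} → SCS n u x T → ∀ j → 1 ℕ.≤ j → j ℕ.≤ n → NodeSCS u x T j
SCS⇒NodeSCS (in-T , out-T , leaving , entering) j 1≤j j≤n = record
  { in-T     = in-T j 1≤j j≤n
  ; out-T    = out-T j 1≤j j≤n
  ; leaving  = λ k 1≤k k<j → leaving j k 1≤k k<j j≤n
  ; entering = λ k 1≤k k<j → entering j k 1≤k k<j j≤n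
  }

NodeSCS⇒SCS : ∀ {n u x T} → (∀ j → 1 ℕ.≤ j → j ℕ.≤ n → NodeSCS u x T j) → SCS n u x T
NodeSCS⇒SCS nodes =
    (λ j 1≤j j≤n → NodeSCS.in-T (nodes j 1≤j j≤n))
  , (λ j 1≤j j≤n → NodeSCS.out-T (nodes j 1≤j j≤n))
  , (λ j k 1≤k k<j j≤n → NodeSCS.leaving (nodes j (NP.≤-trans 1≤k (NP.<⇒≤ k<j)) j≤n) k 1≤k k<j)
  , (λ j k 1≤k k<j j≤n → NodeSCS.entering (nodes j (NP.≤-trans 1≤k (NP.<⇒≤ k<j)) j≤n) k 1≤k k<j)

record NodeExtension (m : ℕ) (u x u′ x′ : Arc → ℚ) : Set where
  field
    sourceΔ sinkΔ : ℕ → ℚ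
    x-source  : ∀ j → j ℕ.≤ m → x′ (sA j) ≡ x (sA j) + sourceΔ j
    u-source  : ∀ j → j ℕ.≤ m → u′ (sA j) ≡ u (sA j) + sourceΔ j
    x-sink    : ∀ j → j ℕ.≤ m → x′ (tA j) ≡ x (tA j) + sinkΔ j
    u-sink    : ∀ j → j ℕ.≤ m → u′ (tA j) ≡ u (tA j) + sinkΔ j
    x-middle  : ∀ i j → i ℕ.≤ m → x′ (mA i j) ≡ x (mA i j)
    u-middle  : ∀ i j → i ℕ.≤ m → u′ (mA i j) ≡ u (mA i j)
    Δ-nonNeg  : ∀ j → 1 ℕ.≤ j → j ℕ.≤ m → 0ℚ ≤ sourceΔ j × 0ℚ ≤ sinkΔ j
    new-arc-bounds : ∀ j → 1 ℕ.≤ j → j ℕ.≤ m →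
                     0ℚ ≤ x′ (mA (suc m) j) × x′ (mA (suc m) j) ≤ u′ (mA (suc m) j)
    balanced  : ∀ j → 1 ℕ.≤ j → j ℕ.≤ m → sourceΔ j + x′ (mA (suc m) j) ≡ sinkΔ j
    new-source-bounds : 0ℚ ≤ x′ (sA (suc m)) × x′ (sA (suc m)) ≤ u′ (sA (suc m))
    new-sink-bounds   : 0ℚ ≤ x′ (tA (suc m)) × x′ (tA (suc m)) ≤ u′ (tA (suc m))
    new-conserved     : x′ (sA (suc m)) ≡ x′ (tA (suc m)) + sumR m (λ j → x′ (mA (suc m) j))

module _ {m u x u′ x′} (E : NodeExtension m u x u′ x′) where
  open NodeExtension E

  extend-Feasible : Feasible m u x → Feasible (suc m) u′ x′
  extend-Feasible (bounds , middle-bounds , conserved) = bounds′ , middle-bounds′ , conserved′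
    where
    SinkSourceBounds : (Arc → ℚ) → (Arc → ℚ) → ℕ → Set
    SinkSourceBounds u x j = (0ℚ ≤ x (sA j) × x (sA j) ≤ u (sA j)) × (0ℚ ≤ x (tA j) × x (tA j) ≤ u (tA j))

    grow : ∀ {j} → j ℕ.≤ m → 1 ℕ.≤ j → SinkSourceBounds u′ x′ j
    grow {j} j≤m 1≤j with bounds j 1≤j j≤m | Δ-nonNeg j 1≤j j≤m
    ... | (0≤xs , xs≤us) , (0≤xt , xt≤ut) | 0≤Δs , 0≤Δt =
        ( subst (0ℚ ≤_) (sym (x-source j j≤m)) (QP.+-mono-≤ 0≤xs 0≤Δs)
        , subst₂ _≤_ (sym (x-source j j≤m)) (sym (u-source j j≤m)) (QP.+-monoˡ-≤ (sourceΔ j) xs≤us) )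
      , ( subst (0ℚ ≤_) (sym (x-sink j j≤m)) (QP.+-mono-≤ 0≤xt 0≤Δt)
        , subst₂ _≤_ (sym (x-sink j j≤m)) (sym (u-sink j j≤m)) (QP.+-monoˡ-≤ (sinkΔ j) xt≤ut) )

    bounds′ : ∀ j → 1 ℕ.≤ j → j ℕ.≤ suc m → SinkSourceBounds u′ x′ j
    bounds′ j 1≤j j≤n =
      ≤-suc-elim (λ j → 1 ℕ.≤ j → SinkSourceBounds u′ x′ j)
        grow (λ _ → new-source-bounds , new-sink-bounds) j≤n 1≤j

    middle-bounds′ : ∀ i j → 1 ℕ.≤ j → j ℕ.< i → i ℕ.≤ suc m →
                     0ℚ ≤ x′ (mA i j) × x′ (mA i j) ≤ u′ (mA i j)
    middle-bounds′ i j 1≤j j<i i≤n =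
      ≤-suc-elim (λ i → j ℕ.< i → 0ℚ ≤ x′ (mA i j) × x′ (mA i j) ≤ u′ (mA i j))
        (λ {i} i≤m j<i → subst (0ℚ ≤_) (sym (x-middle i j i≤m)) (proj₁ (middle-bounds i j 1≤j j<i i≤m))
                       , subst₂ _≤_ (sym (x-middle i j i≤m)) (sym (u-middle i j i≤m))
                                    (proj₂ (middle-bounds i j 1≤j j<i i≤m)))
        (λ j<n → new-arc-bounds j 1≤j (NP.≤-pred j<n))
        i≤n j<i

    Conserved : ℕ → Set
    Conserved j = x′ (sA j) + sumR (suc m) (λ i → when (j <ᵇ i) (x′ (mA i j)))
                ≡ x′ (tA j) + sumR (suc m) (λ k → when (k <ᵇ j) (x′ (mA j k)))

    old-conserved : ∀ {j} → j ℕ.≤ m → 1 ℕ.≤ j → Conserved j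
    old-conserved {j} j≤m 1≤j = begin
      x′ (sA j) + (sumR m (λ i → when (j <ᵇ i) (x′ (mA i j))) + when (j <ᵇ suc m) (x′ (mA (suc m) j)))
        ≡⟨ cong₂ _+_ (x-source j j≤m)
             (cong₂ _+_ (sumR-cong m (λ i _ i≤m → cong (when (j <ᵇ i)) (x-middle i j i≤m)))
                        (if-true (<ᵇ-true (s≤s j≤m)))) ⟩
      (x (sA j) + sourceΔ j) + (inflow j + x′ (mA (suc m) j))
        ≡⟨ interchange (x (sA j)) (sourceΔ j) (inflow j) (x′ (mA (suc m) j)) ⟩
      (x (sA j) + inflow j) + (sourceΔ j + x′ (mA (suc m) j))
        ≡⟨ cong₂ _+_ (conserved j 1≤j j≤m) (balanced j 1≤j j≤m) ⟩
      (x (tA j) + outflow j) + sinkΔ j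
        ≡⟨ regroup (x (tA j)) (outflow j) (sinkΔ j) ⟩
      (x (tA j) + sinkΔ j) + (outflow j + 0ℚ)
        ≡⟨ cong₂ _+_ (x-sink j j≤m)
             (cong₂ _+_ (sumR-cong m (λ k _ _ → cong (when (k <ᵇ j)) (x-middle j k j≤m)))
                        (if-false (<ᵇ-false (NP.m≤n⇒m≤1+n j≤m)))) ⟨
      x′ (tA j) + (sumR m (λ k → when (k <ᵇ j) (x′ (mA j k))) + when (suc m <ᵇ j) (x′ (mA j (suc m))))
        ∎
      where
      open ≡-Reasoning
      open MinCut m u x using (inflow; outflow)
      interchange : ∀ a b c d → (a + b) + (c + d) ≡ (a + c) + (b + d)
      interchange = solve-∀ ℚ-ring
      regroup : ∀ a b c → (a + b) + c ≡ (a + c) + (b + 0ℚ)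
      regroup = solve-∀ ℚ-ring

    new-conserved′ : 1 ℕ.≤ suc m → Conserved (suc m)
    new-conserved′ _ = begin
      x′ (sA (suc m)) + sumR (suc m) (λ i → when (suc m <ᵇ i) (x′ (mA i (suc m))))
        ≡⟨ cong (x′ (sA (suc m)) +_) (sumR-zero (suc m) (λ i _ i≤n → if-false (<ᵇ-false i≤n))) ⟩
      x′ (sA (suc m)) + 0ℚ
        ≡⟨ QP.+-identityʳ (x′ (sA (suc m))) ⟩
      x′ (sA (suc m))
        ≡⟨ new-conserved ⟩
      x′ (tA (suc m)) + sumR m (λ k → x′ (mA (suc m) k))
        ≡⟨ cong (x′ (tA (suc m)) +_) (sumR-cong m (λ k _ k≤m → if-true (<ᵇ-true (s≤s k≤m)))) ⟨
      x′ (tA (suc m)) + sumR m (λ k → when (k <ᵇ suc m) (x′ (mA (suc m) k)))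
        ≡⟨ cong (x′ (tA (suc m)) +_) (QP.+-identityʳ _) ⟨
      x′ (tA (suc m)) + (sumR m (λ k → when (k <ᵇ suc m) (x′ (mA (suc m) k))) + 0ℚ)
        ≡⟨ cong (λ w → x′ (tA (suc m)) + (sumR m (λ k → when (k <ᵇ suc m) (x′ (mA (suc m) k))) + w))
                (if-false (<ᵇ-false (NP.≤-refl {suc m}))) ⟨
      x′ (tA (suc m)) + sumR (suc m) (λ k → when (k <ᵇ suc m) (x′ (mA (suc m) k)))
        ∎
      where open ≡-Reasoning

    conserved′ : ∀ j → 1 ℕ.≤ j → j ℕ.≤ suc m → Conserved j
    conserved′ j 1≤j j≤n = ≤-suc-elim (λ j → 1 ℕ.≤ j → Conserved j) old-conserved new-conserved′ j≤n 1≤j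

  extend-NodeSCS : ∀ {T j} → j ℕ.≤ m → NodeSCS u x T j → NodeSCS u′ x′ T j
  extend-NodeSCS {T} {j} j≤m node = record
    { in-T     = λ Tj → subst₂ _<_ (sym (x-source j j≤m)) (sym (u-source j j≤m))
                          (QP.+-monoˡ-< (sourceΔ j) (proj₁ (in-T Tj)))
                      , trans (x-sink j j≤m) (trans (cong (_+ sinkΔ j) (proj₂ (in-T Tj))) (sym (u-sink j j≤m)))
    ; out-T    = λ Tj → trans (x-source j j≤m) (trans (cong (_+ sourceΔ j) (proj₁ (out-T Tj))) (sym (u-source j j≤m)))
                      , subst₂ _<_ (sym (x-sink j j≤m)) (sym (u-sink j j≤m))
                          (QP.+-monoˡ-< (sinkΔ j) (proj₂ (out-T Tj)))
    ; leaving  = λ k 1≤k k<j Tj Tk →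
        trans (x-middle j k j≤m) (trans (leaving k 1≤k k<j Tj Tk) (sym (u-middle j k j≤m)))
    ; entering = λ k 1≤k k<j Tj Tk → trans (x-middle j k j≤m) (entering k 1≤k k<j Tj Tk)
    }
    where open NodeSCS node

  extend-SCS : ∀ {T} → SCS m u x T → NodeSCS u′ x′ T (suc m) → SCS (suc m) u′ x′ T
  extend-SCS {T} scs new = NodeSCS⇒SCS (λ j 1≤j j≤n →
    ≤-suc-elim (λ j → 1 ℕ.≤ j → NodeSCS u′ x′ T j)
      (λ {j} j≤m 1≤j → extend-NodeSCS j≤m (SCS⇒NodeSCS scs j 1≤j j≤m)) (λ _ → new) j≤n 1≤j)

InUnitInterval : ℚ → Set
InUnitInterval p = 0ℚ < p × p < 1ℚ

capAt : ℕ → (ℕ → Bool) → Arc → ℚ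
capAt n T = cap n (proj₁ (point n T)) (proj₂ (point n T))

record Certified (n : ℕ) (T : ℕ → Bool) : Set where
  field
    feasible : Feasible n (capAt n T) (flow n T)
    scs      : SCS n (capAt n T) (flow n T) T
    λ-bounds : InUnitInterval (proj₁ (point n T))
    μ-bounds : InUnitInterval (proj₂ (point n T))

scaled-InUnitInterval : ∀ {d y z} → 0ℚ < d → d * y ≡ z → 0ℚ < z → z < d → InUnitInterval y
scaled-InUnitInterval {d} {y} 0<d dy≡z 0<z z<d =
    QP.*-cancelˡ-<-nonNeg d {{nonNegative (QP.<⇒≤ 0<d)}} (subst₂ _<_ (sym (QP.*-zeroʳ d)) (sym dy≡z) 0<z)
  , QP.*-cancelˡ-<-nonNeg d {{nonNegative (QP.<⇒≤ 0<d)}} (subst₂ _<_ (sym dy≡z) (sym (QP.*-identityʳ d)) z<d)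

module Capacities (k : ℕ) (l μ l′ μ′ : ℚ) where

  m n : ℕ
  m = suc k
  n = suc m

  source-old : ∀ {j} → j ℕ.≤ m → cap n l′ μ′ (sA j) ≡ a m j * (ι 4 * l′) + b m j * ((1ℚ + θ n) * μ′)
  source-old {j} j≤m = begin
    a n j * l′ + b n j * μ′
      ≡⟨ cong₂ (λ A B → A * l′ + B * μ′) (a-old (s≤s j≤m)) (b-old (s≤s j≤m)) ⟩
    (ι 4 * a m j) * l′ + ((1ℚ + θ n) * b m j) * μ′
      ≡⟨ reassoc (a m j) (b m j) (1ℚ + θ n) l′ μ′ ⟩
    a m j * (ι 4 * l′) + b m j * ((1ℚ + θ n) * μ′)
      ∎
    where
    open ≡-Reasoning
    reassoc : ∀ A B c L M → (ι 4 * A) * L + (c * B) * M ≡ A * (ι 4 * L) + B * (c * M)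
    reassoc = solve-∀ ℚ-ring

  source-new : cap n l′ μ′ (sA n) ≡ φ n * l′ + μ′
  source-new =
    trans (cong₂ (λ A B → A * l′ + B * μ′) (a-new k) (b-new k)) (cong (φ n * l′ +_) (QP.*-identityˡ μ′))

  sink-old : ∀ {j} → j ℕ.≤ m → cap n l′ μ′ (tA j) ≡ cap m l μ (tA j) + θ n * b m j
  sink-old j≤m = if-true (<ᵇ-true (s≤s j≤m))

  sink-new : cap n l′ μ′ (tA n) ≡ φ n ÷' ι 2
  sink-new = if-false (<ᵇ-false (NP.≤-refl {n}))

  middle-old : ∀ i j → i ℕ.≤ m → cap n l′ μ′ (mA i j) ≡ cap m l μ (mA i j)
  middle-old i j i≤m = if-true (<ᵇ-true (s≤s i≤m))

  middle-new : ∀ j → cap n l′ μ′ (mA n j) ≡ dd n j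
  middle-new j = if-false (<ᵇ-false (NP.≤-refl {n}))

module Step (k : ℕ) (T : ℕ → Bool) (certified : Certified (suc k) T) where

  m n : ℕ
  m = suc k
  n = suc m

  l μ l′ μ′ : ℚ
  l  = proj₁ (point m T)
  μ  = proj₂ (point m T)
  l′ = proj₁ (point n T)
  μ′ = proj₂ (point n T)

  u x u′ x′ : Arc → ℚ
  u  = capAt m T
  x  = flow m T
  u′ = capAt n T
  x′ = flow n T

  open Certified certified renaming (feasible to old-feasible; scs to old-scs)
  open Capacities k l μ l′ μ′ hiding (m; n)

  bounds : CoefficientBounds m
  bounds = proj₁ (coefficientBounds k)

  4≤φ : ι 4 ≤ φ n
  4≤φ = proj₂ (coefficientBounds k)

  0≤φ : 0ℚ ≤ φ n
  0≤φ = QP.≤-trans (ι-nonNeg 4) 4≤φ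

  0≤θ : 0ℚ ≤ θ n
  0≤θ = *-nonNeg (ι-nonNeg 3) (a-nonNeg bounds m (s≤s z≤n) NP.≤-refl)

  0<1+θ : 0ℚ < 1ℚ + θ n
  0<1+θ = QP.+-mono-<-≤ (ι-pos 0) 0≤θ

  0≤θb : ∀ j → 1 ℕ.≤ j → j ℕ.≤ m → 0ℚ ≤ θ n * b m j
  0≤θb j 1≤j j≤m = *-nonNeg 0≤θ (QP.≤-trans 0≤1 (b≥1 bounds j 1≤j j≤m))

  half-φ : ι 2 * (φ n ÷' ι 2) ≡ φ n
  half-φ = *-÷'-inverse (φ n) (ι 2) (pos⇒≢0 (ι-pos 1))

  0≤half-φ : 0ℚ ≤ φ n ÷' ι 2
  0≤half-φ = QP.*-cancelˡ-≤-pos (ι 2) {{positive (ι-pos 1)}}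
               (subst₂ _≤_ (sym (QP.*-zeroʳ (ι 2))) (sym half-φ) 0≤φ)

  point-step : ∀ {β} → T n ≡ β → point n T ≡ pointStep n β (point m T)
  point-step Tn = cong (λ β → pointStep n β (point m T)) Tn

  flow-step : ∀ {β} → T n ≡ β → ∀ e → x′ e ≡ flowStep n β (point n T) x e
  flow-step Tn e = cong (λ β → flowStep n β (point n T) x e) Tn

  x-mA-old : ∀ {β} → T n ≡ β → ∀ i j → i ℕ.≤ m → x′ (mA i j) ≡ x (mA i j)
  x-mA-old {true}  Tn i j i≤m = trans (flow-step Tn (mA i j)) (if-true (<ᵇ-true (s≤s i≤m)))
  x-mA-old {false} Tn i j i≤m = trans (flow-step Tn (mA i j)) (if-true (<ᵇ-true (s≤s i≤m)))

  x-tA-old : ∀ {β} → T n ≡ β → ∀ j → j ℕ.≤ m → x′ (tA j) ≡ x (tA j) + θ n * b m j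
  x-tA-old {true}  Tn j j≤m = trans (flow-step Tn (tA j)) (if-true (<ᵇ-true (s≤s j≤m)))
  x-tA-old {false} Tn j j≤m = trans (flow-step Tn (tA j)) (if-true (<ᵇ-true (s≤s j≤m)))

  module In-T (Tn : T n ≡ true) where

    4l′≡l+3 : ι 4 * l′ ≡ l + ι 3
    4l′≡l+3 =
      trans (cong (λ p → ι 4 * proj₁ p) (point-step Tn)) (*-÷'-inverse (l + ι 3) (ι 4) (pos⇒≢0 (ι-pos 3)))

    [1+θ]μ′≡μ : (1ℚ + θ n) * μ′ ≡ μ
    [1+θ]μ′≡μ =
      trans (cong (λ p → (1ℚ + θ n) * proj₂ p) (point-step Tn)) (*-÷'-inverse μ (1ℚ + θ n) (pos⇒≢0 0<1+θ))

    λ′-bounds : InUnitInterval l′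
    λ′-bounds = scaled-InUnitInterval (ι-pos 3) 4l′≡l+3
      (QP.+-mono-<-≤ (proj₁ λ-bounds) (ι-nonNeg 3)) (QP.+-monoˡ-< (ι 3) (proj₂ λ-bounds))

    μ′-bounds : InUnitInterval μ′
    μ′-bounds = scaled-InUnitInterval 0<1+θ [1+θ]μ′≡μ
      (proj₁ μ-bounds) (QP.<-≤-trans (proj₂ μ-bounds) (≤-by-slack (θ n) 0≤θ refl))

    x-mA-new : ∀ j → x′ (mA n j) ≡ dd n j
    x-mA-new j = trans (flow-step Tn (mA n j)) (if-false (<ᵇ-false (NP.≤-refl {n})))

    x-sA-new : x′ (sA n) ≡ φ n ÷' ι 2 + sumR m (dd n)
    x-sA-new = trans (flow-step Tn (sA n)) (if-false (<ᵇ-false (NP.≤-refl {n})))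

    x-tA-new : x′ (tA n) ≡ φ n ÷' ι 2
    x-tA-new = trans (flow-step Tn (tA n)) (if-false (<ᵇ-false (NP.≤-refl {n})))

    source-strict : x′ (sA n) < u′ (sA n)
    source-strict = subst₂ _<_ (sym x-sA-new) (sym source-new)
      (source-arc-unsaturated {s = sumR m (dd n)} {h = φ n ÷' ι 2}
         (ι4*sumR-dd≤φ k) (QP.<-≤-trans (ι-pos 3) 4≤φ) half-φ 4l′≡l+3
         (proj₁ λ-bounds) (QP.<⇒≤ (proj₁ μ′-bounds)))

    0≤sumR-dd : 0ℚ ≤ sumR m (dd n)
    0≤sumR-dd = sumR-nonNeg m (dd-nonNeg bounds)

    extension : NodeExtension m u x u′ x′
    extension = record
      { sourceΔ  = λ j → ι 3 * a m j
      ; sinkΔ    = λ j → θ n * b m j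
      ; x-source = λ j j≤m → trans (flow-step Tn (sA j)) (if-true (<ᵇ-true (s≤s j≤m)))
      ; u-source = λ j j≤m → trans (source-old j≤m)
          (trans (cong₂ (λ L M → a m j * L + b m j * M) 4l′≡l+3 [1+θ]μ′≡μ) (regroup (a m j) (b m j) l μ))
      ; x-sink   = x-tA-old Tn
      ; u-sink   = λ j → sink-old
      ; x-middle = x-mA-old Tn
      ; u-middle = middle-old
      ; Δ-nonNeg = λ j 1≤j j≤m → *-nonNeg (ι-nonNeg 3) (a-nonNeg bounds j 1≤j j≤m) , 0≤θb j 1≤j j≤m
      ; new-arc-bounds = λ j 1≤j j≤m →
            subst (0ℚ ≤_) (sym (x-mA-new j)) (dd-nonNeg bounds j 1≤j j≤m)
          , QP.≤-reflexive (trans (x-mA-new j) (sym (middle-new j)))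
      ; balanced = λ j _ _ → trans (cong (ι 3 * a m j +_) (x-mA-new j)) (add-sub (ι 3 * a m j) (θ n * b m j))
      ; new-source-bounds = subst (0ℚ ≤_) (sym x-sA-new) (QP.+-mono-≤ 0≤half-φ 0≤sumR-dd) , QP.<⇒≤ source-strict
      ; new-sink-bounds   = subst (0ℚ ≤_) (sym x-tA-new) 0≤half-φ
                          , QP.≤-reflexive (trans x-tA-new (sym sink-new))
      ; new-conserved     = trans x-sA-new
          (cong₂ _+_ (sym x-tA-new) (sumR-cong m (λ j _ _ → sym (x-mA-new j))))
      }
      where
      regroup : ∀ A B l μ → A * (l + ι 3) + B * μ ≡ (A * l + B * μ) + ι 3 * A
      regroup = solve-∀ ℚ-ring
      add-sub : ∀ A B → A + (B - A) ≡ B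
      add-sub = solve-∀ ℚ-ring

    new-node-SCS : NodeSCS u′ x′ T n
    new-node-SCS = record
      { in-T     = λ _ → source-strict , trans x-tA-new (sym sink-new)
      ; out-T    = λ Tn≡false → contradiction (trans (sym Tn) Tn≡false) λ ()
      ; leaving  = λ j _ _ _ _ → trans (x-mA-new j) (sym (middle-new j))
      ; entering = λ _ _ _ Tn≡false → contradiction (trans (sym Tn) Tn≡false) λ ()
      }

    certified′ : Certified n T
    certified′ = record
      { feasible = extend-Feasible extension old-feasible
      ; scs      = extend-SCS extension old-scs new-node-SCS
      ; λ-bounds = λ′-bounds
      ; μ-bounds = μ′-bounds
      }

  module Out-T (Tn : T n ≡ false) where

    4l′≡l : ι 4 * l′ ≡ l
    4l′≡l = trans (cong (λ p → ι 4 * proj₁ p) (point-step Tn)) (*-÷'-inverse l (ι 4) (pos⇒≢0 (ι-pos 3)))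

    [1+θ]μ′≡μ+θ : (1ℚ + θ n) * μ′ ≡ μ + θ n
    [1+θ]μ′≡μ+θ =
      trans (cong (λ p → (1ℚ + θ n) * proj₂ p) (point-step Tn))
            (*-÷'-inverse (μ + θ n) (1ℚ + θ n) (pos⇒≢0 0<1+θ))

    λ′-bounds : InUnitInterval l′
    λ′-bounds = scaled-InUnitInterval (ι-pos 3) 4l′≡l
      (proj₁ λ-bounds) (QP.<-trans (proj₂ λ-bounds) (decide-< 1ℚ (ι 4)))

    μ′-bounds : InUnitInterval μ′
    μ′-bounds = scaled-InUnitInterval 0<1+θ [1+θ]μ′≡μ+θ
      (QP.+-mono-<-≤ (proj₁ μ-bounds) 0≤θ) (QP.+-monoˡ-< (θ n) (proj₂ μ-bounds))

    x-mA-new : ∀ j → x′ (mA n j) ≡ 0ℚ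
    x-mA-new j = trans (flow-step Tn (mA n j)) (if-false (<ᵇ-false (NP.≤-refl {n})))

    x-sA-new : x′ (sA n) ≡ φ n * l′ + μ′
    x-sA-new = trans (flow-step Tn (sA n)) (if-false (<ᵇ-false (NP.≤-refl {n})))

    x-tA-new : x′ (tA n) ≡ φ n * l′ + μ′
    x-tA-new = trans (flow-step Tn (tA n)) (if-false (<ᵇ-false (NP.≤-refl {n})))

    0≤x-new : 0ℚ ≤ φ n * l′ + μ′
    0≤x-new = QP.+-mono-≤ (*-nonNeg 0≤φ (QP.<⇒≤ (proj₁ λ′-bounds))) (QP.<⇒≤ (proj₁ μ′-bounds))

    sink-strict : x′ (tA n) < u′ (tA n)
    sink-strict = subst₂ _<_ (sym x-tA-new) (sym sink-new)
      (sink-arc-unsaturated 4≤φ half-φ 4l′≡l (proj₂ λ-bounds) (proj₂ μ′-bounds))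

    extension : NodeExtension m u x u′ x′
    extension = record
      { sourceΔ  = λ j → θ n * b m j
      ; sinkΔ    = λ j → θ n * b m j
      ; x-source = λ j j≤m → trans (flow-step Tn (sA j)) (if-true (<ᵇ-true (s≤s j≤m)))
      ; u-source = λ j j≤m → trans (source-old j≤m)
          (trans (cong₂ (λ L M → a m j * L + b m j * M) 4l′≡l [1+θ]μ′≡μ+θ)
                 (regroup (a m j) (b m j) l μ (θ n)))
      ; x-sink   = x-tA-old Tn
      ; u-sink   = λ j → sink-old
      ; x-middle = x-mA-old Tn
      ; u-middle = middle-old
      ; Δ-nonNeg = λ j 1≤j j≤m → 0≤θb j 1≤j j≤m , 0≤θb j 1≤j j≤m
      ; new-arc-bounds = λ j 1≤j j≤m →
            QP.≤-reflexive (sym (x-mA-new j))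
          , subst₂ _≤_ (sym (x-mA-new j)) (sym (middle-new j)) (dd-nonNeg bounds j 1≤j j≤m)
      ; balanced = λ j _ _ → trans (cong (θ n * b m j +_) (x-mA-new j)) (QP.+-identityʳ (θ n * b m j))
      ; new-source-bounds = subst (0ℚ ≤_) (sym x-sA-new) 0≤x-new , QP.≤-reflexive (trans x-sA-new (sym source-new))
      ; new-sink-bounds   = subst (0ℚ ≤_) (sym x-tA-new) 0≤x-new , QP.<⇒≤ sink-strict
      ; new-conserved     = begin
          x′ (sA n)                                  ≡⟨ trans x-sA-new (sym x-tA-new) ⟩
          x′ (tA n)                                  ≡⟨ QP.+-identityʳ (x′ (tA n)) ⟨
          x′ (tA n) + 0ℚ                             ≡⟨ cong (x′ (tA n) +_) (sumR-zero m (λ j _ _ → x-mA-new j)) ⟨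
          x′ (tA n) + sumR m (λ j → x′ (mA n j))     ∎
      }
      where
      open ≡-Reasoning
      regroup : ∀ A B l μ t → A * l + B * (μ + t) ≡ (A * l + B * μ) + t * B
      regroup = solve-∀ ℚ-ring

    new-node-SCS : NodeSCS u′ x′ T n
    new-node-SCS = record
      { in-T     = λ Tn≡true → contradiction (trans (sym Tn≡true) Tn) λ ()
      ; out-T    = λ _ → trans x-sA-new (sym source-new) , sink-strict
      ; leaving  = λ _ _ _ Tn≡true → contradiction (trans (sym Tn≡true) Tn) λ ()
      ; entering = λ j _ _ _ _ → x-mA-new j
      }

    certified′ : Certified n T
    certified′ = record
      { feasible = extend-Feasible extension old-feasible
      ; scs      = extend-SCS extension old-scs new-node-SCS
      ; λ-bounds = λ′-bounds
      ; μ-bounds = μ′-bounds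
      }

  certified′ : Certified n T
  certified′ with T n in Tn
  ... | true  = In-T.certified′ Tn
  ... | false = Out-T.certified′ Tn

certified-1 : ∀ T → Certified 1 T
certified-1 T = record
  { feasible = (λ { _ (s≤s z≤n) (s≤s z≤n) → source-sink-bounds })
             , (λ { _ _ (s≤s z≤n) (s≤s (s≤s _)) (s≤s ()) })
             , (λ { _ (s≤s z≤n) (s≤s z≤n) → refl })
  ; scs      = (λ { _ (s≤s z≤n) (s≤s z≤n) → in-T })
             , (λ { _ (s≤s z≤n) (s≤s z≤n) → out-T })
             , (λ { _ _ (s≤s z≤n) (s≤s (s≤s _)) (s≤s ()) })
             , (λ { _ _ (s≤s z≤n) (s≤s (s≤s _)) (s≤s ()) })
  ; λ-bounds = λ-bounds
  ; μ-bounds = μ-bounds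
  }
  where
  u x : Arc → ℚ
  u = capAt 1 T
  x = flow 1 T

  source-sink-bounds : (0ℚ ≤ x (sA 1) × x (sA 1) ≤ u (sA 1)) × (0ℚ ≤ x (tA 1) × x (tA 1) ≤ u (tA 1))
  source-sink-bounds with T 1
  ... | true  = (QP.≤ᵇ⇒≤ _ , QP.≤ᵇ⇒≤ _) , (QP.≤ᵇ⇒≤ _ , QP.≤ᵇ⇒≤ _)
  ... | false = (QP.≤ᵇ⇒≤ _ , QP.≤ᵇ⇒≤ _) , (QP.≤ᵇ⇒≤ _ , QP.≤ᵇ⇒≤ _)

  in-T : T 1 ≡ true → x (sA 1) < u (sA 1) × x (tA 1) ≡ u (tA 1)
  in-T T1 rewrite T1 = decide-< _ _ , refl

  out-T : T 1 ≡ false → x (sA 1) ≡ u (sA 1) × x (tA 1) < u (tA 1)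
  out-T T1 rewrite T1 = refl , decide-< _ _

  λ-bounds : InUnitInterval (proj₁ (point 1 T))
  λ-bounds with T 1
  ... | true  = decide-< _ _ , decide-< _ _
  ... | false = decide-< _ _ , decide-< _ _

  μ-bounds : InUnitInterval (proj₂ (point 1 T))
  μ-bounds with T 1
  ... | true  = decide-< _ _ , decide-< _ _
  ... | false = decide-< _ _ , decide-< _ _

certified : ∀ k T → Certified (suc k) T
certified zero    T = certified-1 T
certified (suc k) T = Step.certified′ k T (certified k T)

lemma4 : (n : ℕ) → 2 ℕ.≤ n → (S : ℕ → Bool) → (∀ j → S j ≡ true → 1 ℕ.≤ j × j ℕ.< n) →
    Feasible n (cap n (proj₁ (point n (addN S n))) (proj₂ (point n (addN S n)))) (flow n (addN S n))
    × SCS n (cap n (proj₁ (point n (addN S n))) (proj₂ (point n (addN S n)))) (flow n (addN S n)) (addN S n)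
    × UniqueMinCut n (cap n (proj₁ (point n (addN S n))) (proj₂ (point n (addN S n)))) (addN S n)
lemma4 (suc m) _ S _ = feasible , scs , uniqueMinCut {u = capAt (suc m) T} {x = flow (suc m) T} feasible scs
  where
  T : ℕ → Bool
  T = addN S (suc m)
  open Certified (certified m T)
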